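{- Let $(S,K,I)$ be a balanced split graph such that $\deg_S(v)\notin\{0,1,|V(S)|-1\}$ for all $v\in V(S)$. If $S-E(K)$ does not contain a 4-cycle (as a subgraph), then $S$ is indecomposable.
   Context: A split graph is a graph $S$ whose vertex set can be partitioned into a clique $K$ and an independent set $I$; $(K,I)$ is called a bipartition and $(S,K,I)$ denotes $S$ with this bipartition. $S$ is balanced if it has a unique bipartition. $E(K)$ denotes the set of edges of $S$ with both ends in $K$, so $S-E(K)$ is the bipartite graph obtained by deleting them. For a split graph $(S_1,K_1,I_1)$ and a graph $H$ vertex-disjoint from it, the composition $S_1\circ H$ is the graph obtained from the disjoint union of $S_1$ and $H$ by adding all edges between $K_1$ and $V(H)$ (if $H$ is a split graph with bipartition $(K_2,I_2)$, then $S_1\circ H$ is split with bipartition $(K_1\cup K_2, I_1\cup I_2)$). A graph $G$ is decomposable if $G\cong S_1\circ H$ for some split graph $(S_1,K_1,I_1)$ with nonempty vertex set and some graph $H$ with nonempty vertex set; otherwise $G$ is indecomposable. -}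

module Defs where

open import Data.Nat using (ℕ; zero; suc; _+_; _∸_)
open import Data.Bool using (Bool; true; false; if_then_else_)
open import Data.Fin using (Fin; zero; suc; splitAt)
open import Data.Sum using (_⊎_; inj₁; inj₂)
open import Data.Product using (Σ; _×_; ∃; _,_)
open import Relation.Binary.PropositionalEquality using (_≡_; _≢_)
open import Relation.Nullary using (¬_)
open import Function.Bundles using (_↔_; Inverse)

record Graph (n : ℕ) : Set where
  field
    adj    : Fin n → Fin n → Bool
    sym    : ∀ u v → adj u v ≡ adj v u
    irrefl : ∀ v → adj v v ≡ false
open Graph public

count : ∀ {n} → (Fin n → Bool) → ℕ
count {zero}  P = 0
count {suc n} P = (if P zero then 1 else 0) + count (λ i → P (suc i))

degree : ∀ {n} → Graph n → Fin n → ℕ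
degree G v = count (adj G v)

-- A vertex subset is a Bool-valued predicate. (K , complement of K) is a
-- bipartition of G into a clique K and an independent set I = V ∖ K.
IsClique : ∀ {n} → Graph n → (Fin n → Bool) → Set
IsClique G K = ∀ u v → u ≢ v → K u ≡ true → K v ≡ true → adj G u v ≡ true

IsIndependent : ∀ {n} → Graph n → (Fin n → Bool) → Set
IsIndependent G I = ∀ u v → I u ≡ true → I v ≡ true → adj G u v ≡ false

notB : Bool → Bool
notB true = false
notB false = true

IsBipartition : ∀ {n} → Graph n → (Fin n → Bool) → Set
IsBipartition G K = IsClique G K × IsIndependent G (λ v → notB (K v))

IsSplit : ∀ {n} → Graph n → Set
IsSplit G = ∃ λ K → IsBipartition G K

IsBalanced : ∀ {n} → Graph n → Set
IsBalanced G = IsSplit G ×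
  (∀ K K' → IsBipartition G K → IsBipartition G K' → ∀ v → K v ≡ K' v)

adjMinusEK : ∀ {n} → Graph n → (Fin n → Bool) → Fin n → Fin n → Bool
adjMinusEK G K u v with K u | K v
... | true | true = false
... | _    | _    = adj G u v

Has4Cycle : ∀ {n} → (Fin n → Fin n → Bool) → Set
Has4Cycle {n} A = Σ (Fin n) λ a → Σ (Fin n) λ b → Σ (Fin n) λ c → Σ (Fin n) λ d →
  (a ≢ b × a ≢ c × a ≢ d × b ≢ c × b ≢ d × c ≢ d) ×
  (A a b ≡ true × A b c ≡ true × A c d ≡ true × A d a ≡ true)

compAdj : ∀ {m p} → Graph m → (Fin m → Bool) → Graph p → Fin (m + p) → Fin (m + p) → Bool
compAdj {m} S₁ K₁ H x y with splitAt m x | splitAt m y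
... | inj₁ a | inj₁ b = adj S₁ a b
... | inj₂ a | inj₂ b = adj H a b
... | inj₁ a | inj₂ b = K₁ a
... | inj₂ a | inj₁ b = K₁ b

IsoTo : ∀ {n k} → Graph n → (Fin k → Fin k → Bool) → Set
IsoTo {n} {k} G A = Σ (Fin n ↔ Fin k) λ f →
  ∀ u v → adj G u v ≡ A (Inverse.to f u) (Inverse.to f v)

Decomposable : ∀ {n} → Graph n → Set
Decomposable G = Σ ℕ λ m → Σ ℕ λ p → Σ (Graph (suc m)) λ S₁ →
  Σ (Fin (suc m) → Bool) λ K₁ → Σ (Graph (suc p)) λ H →
  IsBipartition S₁ K₁ × IsoTo G (compAdj S₁ K₁ H)

Indecomposable : ∀ {n} → Graph n → Set
Indecomposable G = ¬ Decomposable G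

-- Suppose S ≅ S₁ ∘ H, so V(S) splits into K₁, I₁ (the sides of S₁) and V(H),
-- with K₁ complete to V(H) and I₁ anticomplete to it. The degree conditions give
-- a vertex i ∈ I₁ with two neighbours k₁ ≠ k₂, both in K₁. Balancedness means no
-- single vertex can be moved across the bipartition (K, I). If i ∈ K, then V(H)
-- lies in I, hence N(i) ⊆ K₁ ⊆ K and i could be moved to I. If i ∈ I, then every
-- h ∈ V(H) lies in K, since otherwise i k₁ h k₂ is a 4-cycle of S − E(K); then
-- K₁ ⊆ K as well, so N(h) ⊆ K and h could be moved to I.
module Submission where

open import Defs renaming (sym to adj-sym)
open import Data.Nat using (zero; suc; _+_; _∸_)
open import Data.Fin using (Fin; zero; suc; splitAt; _↑ˡ_; _↑ʳ_; _≟_)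
open import Data.Fin.Properties using (suc-injective; splitAt-↑ˡ; splitAt-↑ʳ; splitAt⁻¹-↑ˡ)
open import Data.Bool using (Bool; true; false)
open import Data.Sum using (_⊎_; inj₁; inj₂)
open import Data.Empty using (⊥; ⊥-elim)
open import Data.Product using (_×_; ∃; ∃₂; _,_; proj₁; proj₂)
open import Data.Vec.Functional using (updateAt)
open import Data.Vec.Functional.Properties using (updateAt-updates; updateAt-minimal)
open import Function using (_∘_; const)
open import Function.Bundles using (Inverse; Injection)
open import Function.Properties.Inverse using (Inverse⇒Injection)
open import Relation.Binary.PropositionalEquality
  using (_≡_; _≢_; refl; sym; trans; cong)
open import Relation.Nullary using (¬_; yes; no)

≡true⇒≢false : ∀ {b} → b ≡ true → b ≢ false
≡true⇒≢false refl ()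

count≢0⇒∃ : ∀ {n} (P : Fin n → Bool) → count P ≢ 0 → ∃ λ i → P i ≡ true
count≢0⇒∃ {zero}  P c≢0 = ⊥-elim (c≢0 refl)
count≢0⇒∃ {suc n} P c≢0 with P zero in P0
... | true  = zero , P0
... | false with count≢0⇒∃ (P ∘ suc) c≢0
...   | i , Pi = suc i , Pi

count∉01⇒∃₂ : ∀ {n} (P : Fin n → Bool) → count P ≢ 0 → count P ≢ 1 →
  ∃₂ λ i j → i ≢ j × P i ≡ true × P j ≡ true
count∉01⇒∃₂ {zero}  P c≢0 c≢1 = ⊥-elim (c≢0 refl)
count∉01⇒∃₂ {suc n} P c≢0 c≢1 with P zero in P0
... | true with count≢0⇒∃ (P ∘ suc) (c≢1 ∘ cong suc)
...   | j , Pj = zero , suc j , (λ ()) , P0 , Pj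
count∉01⇒∃₂ {suc n} P c≢0 c≢1 | false with count∉01⇒∃₂ (P ∘ suc) c≢0 c≢1
...   | i , j , i≢j , Pi , Pj = suc i , suc j , i≢j ∘ suc-injective , Pi , Pj

count≢n⇒∃false : ∀ {n} (P : Fin n → Bool) → count P ≢ n → ∃ λ i → P i ≡ false
count≢n⇒∃false {zero}  P c≢n = ⊥-elim (c≢n refl)
count≢n⇒∃false {suc n} P c≢n with P zero in P0
... | false = zero , P0
... | true with count≢n⇒∃false (P ∘ suc) (c≢n ∘ cong suc)
...   | i , Pi = suc i , Pi

count≢n∸1⇒∃false : ∀ {n} (P : Fin n → Bool) (x : Fin n) → P x ≡ false →
  count P ≢ n ∸ 1 → ∃ λ y → y ≢ x × P y ≡ false
count≢n∸1⇒∃false {suc n} P zero Px c≢n∸1 rewrite Px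
  with count≢n⇒∃false (P ∘ suc) c≢n∸1
... | i , Pi = suc i , (λ ()) , Pi
count≢n∸1⇒∃false {suc (suc n)} P (suc x) Px c≢n∸1 with P zero in P0
... | false = zero , (λ ()) , P0
... | true with count≢n∸1⇒∃false (P ∘ suc) x Px (c≢n∸1 ∘ cong suc)
...   | y , y≢x , Py = suc y , y≢x ∘ suc-injective , Py

adjacent⇒≢ : ∀ {n} (G : Graph n) {u v} → adj G u v ≡ true → u ≢ v
adjacent⇒≢ G {u} uv refl = ≡true⇒≢false uv (irrefl G u)

adj-symˡ : ∀ {n} (G : Graph n) {u v b} → adj G u v ≡ b → adj G v u ≡ b
adj-symˡ G {u} {v} uv = trans (adj-sym G v u) uv

updateAt-const-inv : ∀ {n} (K : Fin n → Bool) w c v {b} → updateAt K w (const c) v ≡ b →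
  (v ≡ w × c ≡ b) ⊎ (v ≢ w × K v ≡ b)
updateAt-const-inv K w c v eq with v ≟ w
... | yes refl = inj₁ (refl , trans (sym (updateAt-updates w K)) eq)
... | no v≢w   = inj₂ (v≢w , trans (sym (updateAt-minimal v w K v≢w)) eq)

notB≡true : ∀ {b} → notB b ≡ true → b ≡ false
notB≡true {false} _ = refl

adjMinusEK-I : ∀ {n} (G : Graph n) (K : Fin n → Bool) {u v} →
  K u ≡ false ⊎ K v ≡ false → adjMinusEK G K u v ≡ adj G u v
adjMinusEK-I G K {u} {v} _ with K u | K v
adjMinusEK-I G K (inj₁ ()) | true | true
adjMinusEK-I G K (inj₂ ()) | true | true
... | true  | false = refl
... | false | _     = refl

-- The four edges of i k₁ b k₂ each have an end (i or b) outside K.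
¬two-common-neighbours : ∀ {n} (G : Graph n) (K : Fin n → Bool) → ¬ Has4Cycle (adjMinusEK G K) →
  ∀ {i b k₁ k₂} → K i ≡ false → K b ≡ false → i ≢ b → k₁ ≢ k₂ →
  adj G i k₁ ≡ true → adj G i k₂ ≡ true → adj G b k₁ ≡ true → adj G b k₂ ≡ true → ⊥
¬two-common-neighbours G K no-C4 Ki Kb i≢b k₁≢k₂ ik₁ ik₂ bk₁ bk₂ = no-C4 (_ , _ , _ , _ ,
  ( adjacent⇒≢ G ik₁ , i≢b , adjacent⇒≢ G ik₂
  , adjacent⇒≢ G (adj-symˡ G bk₁) , k₁≢k₂ , adjacent⇒≢ G bk₂ ) ,
  ( trans (adjMinusEK-I G K (inj₁ Ki)) ik₁
  , trans (adjMinusEK-I G K (inj₂ Kb)) (adj-symˡ G bk₁)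
  , trans (adjMinusEK-I G K (inj₁ Kb)) bk₂
  , trans (adjMinusEK-I G K (inj₂ Ki)) (adj-symˡ G ik₂) ))

module _ {n} (G : Graph n) {K : Fin n → Bool} (bip : IsBipartition G K) where

  adjacent-to-I⇒K : ∀ {u v} → adj G u v ≡ true → K u ≡ false → K v ≡ true
  adjacent-to-I⇒K {u} {v} uv Ku with K v in Kv
  ... | true  = refl
  ... | false = ⊥-elim (≡true⇒≢false uv (proj₂ bip u v (cong notB Ku) (cong notB Kv)))

  nonadjacent-to-K⇒I : ∀ {u v} → u ≢ v → adj G u v ≡ false → K u ≡ true → K v ≡ false
  nonadjacent-to-K⇒I {u} {v} u≢v uv Ku with K v in Kv
  ... | false = refl
  ... | true  = ⊥-elim (≡true⇒≢false (proj₁ bip u v u≢v Ku Kv) uv)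

  move-into-clique : ∀ w → (∀ v → v ≢ w → K v ≡ true → adj G w v ≡ true) →
    IsBipartition G (updateAt K w (const true))
  move-into-clique w w-K = clique , independent
    where
    clique : IsClique G (updateAt K w (const true))
    clique u v u≢v Ku Kv
      with updateAt-const-inv K w true u Ku | updateAt-const-inv K w true v Kv
    ... | inj₁ (refl , _)   | inj₁ (refl , _)   = ⊥-elim (u≢v refl)
    ... | inj₁ (refl , _)   | inj₂ (v≢w , Kv′) = w-K v v≢w Kv′
    ... | inj₂ (u≢w , Ku′) | inj₁ (refl , _)   = adj-symˡ G (w-K u u≢w Ku′)
    ... | inj₂ (_ , Ku′)   | inj₂ (_ , Kv′)   = proj₁ bip u v u≢v Ku′ Kv′
    independent : IsIndependent G (notB ∘ updateAt K w (const true))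
    independent u v Iu Iv
      with updateAt-const-inv K w true u (notB≡true Iu)
         | updateAt-const-inv K w true v (notB≡true Iv)
    ... | inj₁ (_ , ())   | _
    ... | inj₂ _          | inj₁ (_ , ())
    ... | inj₂ (_ , Ku′) | inj₂ (_ , Kv′) = proj₂ bip u v (cong notB Ku′) (cong notB Kv′)

  move-out-of-clique : ∀ w → (∀ v → adj G w v ≡ true → K v ≡ true) →
    IsBipartition G (updateAt K w (const false))
  move-out-of-clique w N⊆K = clique , independent
    where
    clique : IsClique G (updateAt K w (const false))
    clique u v u≢v Ku Kv
      with updateAt-const-inv K w false u Ku | updateAt-const-inv K w false v Kv
    ... | inj₁ (_ , ())   | _
    ... | inj₂ _          | inj₁ (_ , ())
    ... | inj₂ (_ , Ku′) | inj₂ (_ , Kv′) = proj₁ bip u v u≢v Ku′ Kv′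
    w-I : ∀ v → K v ≡ false → adj G w v ≡ false
    w-I v Kv with adj G w v in wv
    ... | false = refl
    ... | true  = ⊥-elim (≡true⇒≢false (N⊆K v wv) Kv)
    independent : IsIndependent G (notB ∘ updateAt K w (const false))
    independent u v Iu Iv
      with updateAt-const-inv K w false u (notB≡true Iu)
         | updateAt-const-inv K w false v (notB≡true Iv)
    ... | inj₁ (refl , _)   | inj₁ (refl , _)   = irrefl G u
    ... | inj₁ (refl , _)   | inj₂ (_ , Kv′)   = w-I v Kv′
    ... | inj₂ (_ , Ku′)   | inj₁ (refl , _)   = adj-symˡ G (w-I u Ku′)
    ... | inj₂ (_ , Ku′)   | inj₂ (_ , Kv′)   = proj₂ bip u v (cong notB Ku′) (cong notB Kv′)

  module _ (bal : IsBalanced G) where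

    balanced⇒¬removable : ∀ {w} → K w ≡ true → ¬ (∀ v → adj G w v ≡ true → K v ≡ true)
    balanced⇒¬removable {w} Kw N⊆K = ≡true⇒≢false Kw (trans
      (proj₂ bal K _ bip (move-out-of-clique w N⊆K) w) (updateAt-updates w K))

    balanced⇒¬insertable : ∀ {w} → K w ≡ false →
      ¬ (∀ v → v ≢ w → K v ≡ true → adj G w v ≡ true)
    balanced⇒¬insertable {w} Kw w-K = ≡true⇒≢false
      (trans (proj₂ bal K _ bip (move-into-clique w w-K) w) (updateAt-updates w K)) Kw

data Part : Set where
  inK₁ inI₁ inH : Part

-- How a graph isomorphic to S₁ ∘ H looks from inside: a partition of its
-- vertices into K₁, I₁ and V(H), both V(S₁) = K₁ ∪ I₁ and V(H) nonempty,
-- with the adjacencies that the composition prescribes.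
record CompositionPartition {n} (A : Fin n → Fin n → Bool) : Set where
  field
    part        : Fin n → Part
    K₁-K₁       : ∀ {u v} → part u ≡ inK₁ → part v ≡ inK₁ → u ≢ v → A u v ≡ true
    I₁-I₁       : ∀ {u v} → part u ≡ inI₁ → part v ≡ inI₁ → A u v ≡ false
    K₁-H        : ∀ {u v} → part u ≡ inK₁ → part v ≡ inH → A u v ≡ true
    I₁-H        : ∀ {u v} → part u ≡ inI₁ → part v ≡ inH → A u v ≡ false
    hVertex     : Fin n
    hVertex-inH : part hVertex ≡ inH
    s₁Vertex    : Fin n
    s₁Vertex∉H  : part s₁Vertex ≢ inH

sideOf : Bool → Part
sideOf true  = inK₁
sideOf false = inI₁

sideOf≡inK₁ : ∀ {b} → sideOf b ≡ inK₁ → b ≡ true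
sideOf≡inK₁ {true} _ = refl

sideOf≡inI₁ : ∀ {b} → sideOf b ≡ inI₁ → b ≡ false
sideOf≡inI₁ {false} _ = refl

sideOf≢inH : ∀ b → sideOf b ≢ inH
sideOf≢inH true  ()
sideOf≢inH false ()

module _ {m p} {S₁ : Graph (suc m)} {K₁ : Fin (suc m) → Bool} {H : Graph (suc p)} where

  compositionPart : Fin (suc m + suc p) → Part
  compositionPart x with splitAt (suc m) x
  ... | inj₁ a = sideOf (K₁ a)
  ... | inj₂ _ = inH

  composition-partition : IsBipartition S₁ K₁ → CompositionPartition (compAdj S₁ K₁ H)
  composition-partition bip = record
    { part        = compositionPart
    ; K₁-K₁       = λ {u v} → K₁-K₁ {u} {v}
    ; I₁-I₁       = λ {u v} → I₁-I₁ {u} {v}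
    ; K₁-H        = λ {u v} → K₁-H {u} {v}
    ; I₁-H        = λ {u v} → I₁-H {u} {v}
    ; hVertex     = suc m ↑ʳ zero
    ; hVertex-inH = hVertex-inH
    ; s₁Vertex    = zero ↑ˡ suc p
    ; s₁Vertex∉H  = s₁Vertex∉H
    }
    where
    K₁-K₁ : ∀ {u v} → compositionPart u ≡ inK₁ → compositionPart v ≡ inK₁ → u ≢ v →
      compAdj S₁ K₁ H u v ≡ true
    K₁-K₁ {u} {v} pu pv u≢v with splitAt (suc m) u in eu | splitAt (suc m) v in ev
    ... | inj₁ a | inj₁ b = proj₁ bip a b
      (λ { refl → u≢v (trans (sym (splitAt⁻¹-↑ˡ eu)) (splitAt⁻¹-↑ˡ ev)) })
      (sideOf≡inK₁ pu) (sideOf≡inK₁ pv)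
    K₁-K₁ {u} {v} () _ _ | inj₂ _ | _
    K₁-K₁ {u} {v} _ () _ | inj₁ _ | inj₂ _

    I₁-I₁ : ∀ {u v} → compositionPart u ≡ inI₁ → compositionPart v ≡ inI₁ →
      compAdj S₁ K₁ H u v ≡ false
    I₁-I₁ {u} {v} pu pv with splitAt (suc m) u | splitAt (suc m) v
    ... | inj₁ a | inj₁ b =
      proj₂ bip a b (cong notB (sideOf≡inI₁ pu)) (cong notB (sideOf≡inI₁ pv))
    I₁-I₁ {u} {v} () _ | inj₂ _ | _
    I₁-I₁ {u} {v} _ () | inj₁ _ | inj₂ _

    K₁-H : ∀ {u v} → compositionPart u ≡ inK₁ → compositionPart v ≡ inH →
      compAdj S₁ K₁ H u v ≡ true
    K₁-H {u} {v} pu pv with splitAt (suc m) u | splitAt (suc m) v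
    ... | inj₁ a | inj₂ _ = sideOf≡inK₁ pu
    ... | inj₁ _ | inj₁ b = ⊥-elim (sideOf≢inH (K₁ b) pv)
    K₁-H {u} {v} () _ | inj₂ _ | _

    I₁-H : ∀ {u v} → compositionPart u ≡ inI₁ → compositionPart v ≡ inH →
      compAdj S₁ K₁ H u v ≡ false
    I₁-H {u} {v} pu pv with splitAt (suc m) u | splitAt (suc m) v
    ... | inj₁ a | inj₂ _ = sideOf≡inI₁ pu
    ... | inj₁ _ | inj₁ b = ⊥-elim (sideOf≢inH (K₁ b) pv)
    I₁-H {u} {v} () _ | inj₂ _ | _

    hVertex-inH : compositionPart (suc m ↑ʳ zero) ≡ inH
    hVertex-inH rewrite splitAt-↑ʳ (suc m) (suc p) zero = refl

    s₁Vertex∉H : compositionPart (zero ↑ˡ suc p) ≢ inH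
    s₁Vertex∉H rewrite splitAt-↑ˡ (suc m) zero (suc p) = sideOf≢inH (K₁ zero)

iso-partition : ∀ {n k} {G : Graph n} {A : Fin k → Fin k → Bool} →
  IsoTo G A → CompositionPartition A → CompositionPartition (adj G)
iso-partition (f , f-adj) P = record
  { part        = part ∘ to
  ; K₁-K₁       = λ pu pv u≢v → trans (f-adj _ _) (K₁-K₁ pu pv (u≢v ∘ injective))
  ; I₁-I₁       = λ pu pv → trans (f-adj _ _) (I₁-I₁ pu pv)
  ; K₁-H        = λ pu pv → trans (f-adj _ _) (K₁-H pu pv)
  ; I₁-H        = λ pu pv → trans (f-adj _ _) (I₁-H pu pv)
  ; hVertex     = from hVertex
  ; hVertex-inH = trans (cong part (strictlyInverseˡ hVertex)) hVertex-inH
  ; s₁Vertex    = from s₁Vertex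
  ; s₁Vertex∉H  = s₁Vertex∉H ∘ trans (sym (cong part (strictlyInverseˡ s₁Vertex)))
  }
  where
  open CompositionPartition P
  open Inverse f using (to; from; strictlyInverseˡ)
  open Injection (Inverse⇒Injection f) using (injective)

decomposable⇒partition : ∀ {n} {G : Graph n} → Decomposable G → CompositionPartition (adj G)
decomposable⇒partition {G = G} (_ , _ , _ , _ , H , bip₁ , iso) =
  iso-partition {G = G} iso (composition-partition {H = H} bip₁)

module _ {n} (G : Graph n) (P : CompositionPartition (adj G)) where
  open CompositionPartition P

  parts-differ⇒≢ : ∀ {u v} {a b : Part} → part u ≡ a → part v ≡ b → a ≢ b → u ≢ v
  parts-differ⇒≢ pu pv a≢b refl = a≢b (trans (sym pu) pv)

  I₁-neighbour⇒K₁ : ∀ {x y} → part x ≡ inI₁ → adj G x y ≡ true → part y ≡ inK₁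
  I₁-neighbour⇒K₁ {x} {y} px xy with part y in py
  ... | inK₁ = refl
  ... | inI₁ = ⊥-elim (≡true⇒≢false xy (I₁-I₁ px py))
  ... | inH  = ⊥-elim (≡true⇒≢false xy (I₁-H px py))

  K₁-non-neighbour⇒I₁ : ∀ {x y} → part x ≡ inK₁ → y ≢ x → adj G x y ≡ false → part y ≡ inI₁
  K₁-non-neighbour⇒I₁ {x} {y} px y≢x xy with part y in py
  ... | inI₁ = refl
  ... | inK₁ = ⊥-elim (≡true⇒≢false (K₁-K₁ px py (y≢x ∘ sym)) xy)
  ... | inH  = ⊥-elim (≡true⇒≢false (K₁-H px py) xy)

  K₁-vertex : (∀ v → degree G v ≢ 0) → ∃ λ k → part k ≡ inK₁
  K₁-vertex deg≢0 with part s₁Vertex in ps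
  ... | inK₁ = s₁Vertex , ps
  ... | inH  = ⊥-elim (s₁Vertex∉H ps)
  ... | inI₁ with count≢0⇒∃ (adj G s₁Vertex) (deg≢0 s₁Vertex)
  ...   | k , sk = k , I₁-neighbour⇒K₁ ps sk

  I₁-vertex : (∀ v → degree G v ≢ 0) → (∀ v → degree G v ≢ n ∸ 1) → ∃ λ i → part i ≡ inI₁
  I₁-vertex deg≢0 deg≢n∸1 with K₁-vertex deg≢0
  ... | k , pk with count≢n∸1⇒∃false (adj G k) k (irrefl G k) (deg≢n∸1 k)
  ...   | i , i≢k , ki = i , K₁-non-neighbour⇒I₁ pk i≢k ki

  module _ {K : Fin n → Bool} (bip : IsBipartition G K) (bal : IsBalanced G) where

    I₁-vertex∉K : ∀ {i} → part i ≡ inI₁ → K i ≢ true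
    I₁-vertex∉K {i} pi Ki = balanced⇒¬removable G bip bal Ki N⊆K
      where
      Kh : K hVertex ≡ false
      Kh = nonadjacent-to-K⇒I G bip (parts-differ⇒≢ pi hVertex-inH λ ()) (I₁-H pi hVertex-inH) Ki
      N⊆K : ∀ v → adj G i v ≡ true → K v ≡ true
      N⊆K v iv = adjacent-to-I⇒K G bip (adj-symˡ G (K₁-H (I₁-neighbour⇒K₁ pi iv) hVertex-inH)) Kh

    I₁-vertex∉I : ∀ {i k₁ k₂} → ¬ Has4Cycle (adjMinusEK G K) → part i ≡ inI₁ → k₁ ≢ k₂ →
      adj G i k₁ ≡ true → adj G i k₂ ≡ true → K i ≢ false
    I₁-vertex∉I {i} {k₁} {k₂} no-C4 pi k₁≢k₂ ik₁ ik₂ Ki =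
      balanced⇒¬removable G bip bal (H⊆K hVertex-inH) N⊆K
      where
      H⊆K : ∀ {b} → part b ≡ inH → K b ≡ true
      H⊆K {b} pb with K b in Kb
      ... | true  = refl
      ... | false = ⊥-elim (¬two-common-neighbours G K no-C4 Ki Kb
        (parts-differ⇒≢ pi pb λ ()) k₁≢k₂ ik₁ ik₂
        (adj-symˡ G (K₁-H (I₁-neighbour⇒K₁ pi ik₁) pb))
        (adj-symˡ G (K₁-H (I₁-neighbour⇒K₁ pi ik₂) pb)))
      Kh : K hVertex ≡ true
      Kh = H⊆K hVertex-inH
      K₁⊆K : ∀ {v} → part v ≡ inK₁ → K v ≡ true
      K₁⊆K {v} pv with K v in Kv
      ... | true  = refl
      ... | false = ⊥-elim (balanced⇒¬insertable G bip bal Kv v-K)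
        where
        v-K : ∀ u → u ≢ v → K u ≡ true → adj G v u ≡ true
        v-K u u≢v Ku with part u in pu
        ... | inK₁ = K₁-K₁ pv pu (u≢v ∘ sym)
        ... | inH  = K₁-H pv pu
        ... | inI₁ = ⊥-elim (≡true⇒≢false
          (proj₁ bip u hVertex (parts-differ⇒≢ pu hVertex-inH λ ()) Ku Kh) (I₁-H pu hVertex-inH))
      N⊆K : ∀ v → adj G hVertex v ≡ true → K v ≡ true
      N⊆K v hv with part v in pv
      ... | inK₁ = K₁⊆K pv
      ... | inH  = H⊆K pv
      ... | inI₁ = ⊥-elim (≡true⇒≢false hv (adj-symˡ G (I₁-H pv hVertex-inH)))

no-partition : ∀ {n} {G : Graph n} {K : Fin n → Bool} →
  IsBipartition G K → IsBalanced G → ¬ Has4Cycle (adjMinusEK G K) →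
  (∀ v → degree G v ≢ 0) → (∀ v → degree G v ≢ 1) → (∀ v → degree G v ≢ n ∸ 1) →
  ¬ CompositionPartition (adj G)
no-partition {G = G} {K} bip bal no-C4 deg≢0 deg≢1 deg≢n∸1 P
  with I₁-vertex G P deg≢0 deg≢n∸1
... | i , pi with count∉01⇒∃₂ (adj G i) (deg≢0 i) (deg≢1 i)
...   | k₁ , k₂ , k₁≢k₂ , ik₁ , ik₂ with K i in Ki
...     | true  = I₁-vertex∉K G P bip bal pi Ki
...     | false = I₁-vertex∉I G P bip bal no-C4 pi k₁≢k₂ ik₁ ik₂ Ki

mainTheorem3 : ∀ {n} (S : Graph n) (K : Fin n → Bool) →
    IsBipartition S K → IsBalanced S →
    (∀ v → degree S v ≢ 0 × degree S v ≢ 1 × degree S v ≢ n ∸ 1) →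
    ¬ Has4Cycle (adjMinusEK S K) →
    Indecomposable S
mainTheorem3 S K bip bal deg no-C4 =
  no-partition bip bal no-C4 (proj₁ ∘ deg) (proj₁ ∘ proj₂ ∘ deg) (proj₂ ∘ proj₂ ∘ deg)
  ∘ decomposable⇒partition {G = S}
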